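{- For every integer $r\ge 2$, $\frac{2e^{ -1}}{r^2+r} \leq \pi_r \leq \frac{2e^{ -1}}{r^2-r}$, where $\pi_r = \max_{n \ge 1} n^{ -r-1}\, r!\, \binom{n}{r}$.
   Context: The maximum defining $\pi_r$ is over positive integers $n$. -}

module Defs where

open import Data.Nat as ℕ using (ℕ; zero; suc; _!; _^_)
open import Data.Nat.Properties using (_!≢0; m^n≢0)
open import Data.Nat.Combinatorics using (_C_)
open import Data.Integer using (+_)
open import Data.Rational using (ℚ; _/_; _+_; 0ℚ)

-- The quantity maximised in the definition of π_r, for a positive
-- integer n = suc m :   n^{-r-1} · r! · binom(n, r)   (a rational number).
term : ℕ → ℕ → ℚ
term r m = (+ (r ! ℕ.* (suc m C r))) / (suc m ^ suc r)
  where instance _ = m^n≢0 (suc m) (suc r)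

-- Partial sums of Euler's number e = Σ_{k ≥ 0} 1/k!  :
-- eSum N = Σ_{k=0}^{N} 1/k!.  e is the supremum (limit) of eSum.
eSum : ℕ → ℚ
eSum zero = (+ 1) / 1
eSum (suc N) = eSum N + ((+ 1) / (suc N !))
  where instance _ = suc N !≢0

{-# OPTIONS --safe #-}
-- Write e_N = Σ_{j ≤ N} 1/j! and recall r!·C(n,r) = n(n−1)⋯(n−r+1).
-- Upper bound: AM–GM for the r+1 numbers r(r−1)/2, n, n−1, …, n−r+1, whose sum is rn, gives
-- (r(r−1)/2)·r!·C(n,r) ≤ (rn/(r+1))^(r+1).  The truncated exponential satisfies
-- e_N(Mx) ≤ (1−x)^(−M), by induction on M and N from e_{N+1}(y+x) − e_{N+1}(y) ≤ x·e_N(y+x);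
-- at x = 1/(r+1), M = r+1 this is e_N(1) ≤ (1+1/r)^(r+1).  The product of the two is the bound.
-- Lower bound: take n₀ = r(r+1)/2 = a + r with a = r(r−1)/2.  Pairing factors, (n₀−i)(a+i) ≥ n₀a,
-- gives (n₀a)^r ≤ n₀(n₀−1)⋯(n₀−r+1)·a(a+1)⋯(a+r−1), and ∏_{i<r} (1 + i/a) ≤ e_r(Σ_{i<r} i/a) = e_r(1);
-- together with 2n₀ = r²+r this is the bound at n₀.
-- The maximum exists because r!·C(n,r)/n^(r+1) ≤ 1/n drops below its value at n₀ once n ≥ n₀^(r+1).
module Submission where

open import Defs
open import Data.List.Base using ([]; _∷_; length; applyDownFrom; downFrom)
open import Data.Nat.ListAction using (sum; product)
open import Data.Product using (Σ; _×_; _,_; proj₁; proj₂)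
open import Data.Sum using (inj₁; inj₂)
open import Relation.Binary.PropositionalEquality
open import Relation.Nullary using (yes; no)
open import Relation.Binary.Bundles using (TotalPreorder)
open import Function.Base using (case_of_)

module _ where
  open import Data.Nat
  open import Data.Nat.Properties
  open import Data.Nat.Combinatorics using (_C_; nCk≡nPk/k!; nPk≡n!/[n∸k]!; k>n⇒nCk≡0)
  open import Data.Nat.Combinatorics.Base using (_P′_)
  open import Data.Nat.Combinatorics.Specification using (nP′k≡n!/[n∸k]!; k!∣nP′k)
  open import Data.Nat.DivMod using (_/_; m*[n/m]≡n)
  open import Data.Nat.Tactic.RingSolver using (solve-∀)
  open import Data.List.Properties using (length-applyDownFrom)
  open ≤-Reasoning

  ^-distribʳ-* : ∀ m n k → (m * n) ^ k ≡ m ^ k * n ^ k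
  ^-distribʳ-* m n zero = refl
  ^-distribʳ-* m n (suc k) = begin-equality
    m * n * (m * n) ^ k       ≡⟨ cong (m * n *_) (^-distribʳ-* m n k) ⟩
    m * n * (m ^ k * n ^ k)   ≡⟨ regroup m n (m ^ k) (n ^ k) ⟩
    m * m ^ k * (n * n ^ k)   ∎
    where
      regroup : ∀ m n a b → m * n * (a * b) ≡ m * a * (n * b)
      regroup = solve-∀

  bernoulli : ∀ x s j → s ^ suc j + suc j * x * s ^ j ≤ (x + s) ^ suc j
  bernoulli x s zero = ≤-reflexive (expand x s)
    where
      expand : ∀ x s → s * 1 + 1 * x * 1 ≡ (x + s) * 1
      expand = solve-∀
  bernoulli x s (suc j) = begin
    s * S + suc (suc j) * x * S                        ≤⟨ m≤m+n _ (x * (suc j * x * P)) ⟩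
    s * S + suc (suc j) * x * S + x * (suc j * x * P)  ≡⟨ factor x s j P ⟩
    (x + s) * (S + suc j * x * P)                      ≤⟨ *-monoʳ-≤ (x + s) (bernoulli x s j) ⟩
    (x + s) * (x + s) ^ suc j                          ∎
    where
      P = s ^ j
      S = s * P
      factor : ∀ x s j P → s * (s * P) + suc (suc j) * x * (s * P) + x * (suc j * x * P)
                           ≡ (x + s) * (s * P + suc j * x * P)
      factor = solve-∀

  ^-increment-≤ : ∀ x s j → (x + s) ^ suc j ≤ s ^ suc j + suc j * x * (x + s) ^ j
  ^-increment-≤ x s zero = ≤-reflexive (expand x s)
    where
      expand : ∀ x s → (x + s) * 1 ≡ s * 1 + 1 * x * 1
      expand = solve-∀
  ^-increment-≤ x s (suc j) = begin
    (x + s) * (x + s) ^ suc j                              ≤⟨ *-monoʳ-≤ (x + s) (^-increment-≤ x s j) ⟩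
    (x + s) * (S + suc j * x * P)                          ≡⟨ expand x s j S P ⟩
    s * S + suc j * x * ((x + s) * P) + x * S              ≤⟨ +-monoʳ-≤ _ (*-monoʳ-≤ x S≤[x+s]*P) ⟩
    s * S + suc j * x * ((x + s) * P) + x * ((x + s) * P)  ≡⟨ collect x s j S P ⟩
    s * S + suc (suc j) * x * ((x + s) * P)                ∎
    where
      P = (x + s) ^ j
      S = s ^ suc j
      S≤[x+s]*P : S ≤ (x + s) * P
      S≤[x+s]*P = ^-monoˡ-≤ (suc j) (m≤n+m s x)
      expand : ∀ x s j S P → (x + s) * (S + suc j * x * P) ≡ s * S + suc j * x * ((x + s) * P) + x * S
      expand = solve-∀
      collect : ∀ x s j S P → s * S + suc j * x * ((x + s) * P) + x * ((x + s) * P)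
                              ≡ s * S + suc (suc j) * x * ((x + s) * P)
      collect = solve-∀

  -- Young's inequality and AM–GM

  young-above : ∀ k v x → suc k * (x + v) * v ^ k ≤ (x + v) ^ suc k + k * v ^ suc k
  young-above k v x = begin
    suc k * (x + v) * v ^ k                         ≡⟨ split k x v (v ^ k) ⟩
    v ^ suc k + suc k * x * v ^ k + k * v ^ suc k   ≤⟨ +-monoˡ-≤ _ (bernoulli x v k) ⟩
    (x + v) ^ suc k + k * v ^ suc k                 ∎
    where
      split : ∀ k x v V → suc k * (x + v) * V ≡ v * V + suc k * x * V + k * (v * V)
      split = solve-∀

  young-below : ∀ k s x → suc k * s * (x + s) ^ k ≤ s ^ suc k + k * (x + s) ^ suc k
  young-below zero s x = ≤-reflexive (unit s x)
    where
      unit : ∀ s x → 1 * s * 1 ≡ s * 1 + 0 * ((x + s) * 1)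
      unit = solve-∀
  young-below (suc j) s x = begin
    suc (suc j) * s * ((x + s) * P)
      ≡⟨ split j s x P ⟩
    s * ((x + s) * P) + suc j * s * ((x + s) * P)
      ≤⟨ +-monoˡ-≤ _ (*-monoʳ-≤ s (^-increment-≤ x s j)) ⟩
    s * (s ^ suc j + suc j * x * P) + suc j * s * ((x + s) * P)
      ≡⟨ distribute j s x P (s ^ suc j) ⟩
    s * s ^ suc j + suc j * x * (s * P) + suc j * s * ((x + s) * P)
      ≤⟨ +-monoˡ-≤ (suc j * s * ((x + s) * P)) (+-monoʳ-≤ (s * s ^ suc j) (*-monoʳ-≤ (suc j * x) (*-monoˡ-≤ P (m≤n+m s x)))) ⟩
    s * s ^ suc j + suc j * x * ((x + s) * P) + suc j * s * ((x + s) * P)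
      ≡⟨ collect j s x P (s ^ suc j) ⟩
    s * s ^ suc j + suc j * ((x + s) * ((x + s) * P))
      ∎
    where
      P = (x + s) ^ j
      split : ∀ j s x P → suc (suc j) * s * ((x + s) * P) ≡ s * ((x + s) * P) + suc j * s * ((x + s) * P)
      split = solve-∀
      distribute : ∀ j s x P S → s * (S + suc j * x * P) + suc j * s * ((x + s) * P)
                                 ≡ s * S + suc j * x * (s * P) + suc j * s * ((x + s) * P)
      distribute = solve-∀
      collect : ∀ j s x P S → s * S + suc j * x * ((x + s) * P) + suc j * s * ((x + s) * P)
                              ≡ s * S + suc j * ((x + s) * ((x + s) * P))
      collect = solve-∀

  young : ∀ k s v → suc k * s * v ^ k ≤ s ^ suc k + k * v ^ suc k
  young k s v with ≤-total v s
  ... | inj₁ v≤s = subst (λ s → suc k * s * v ^ k ≤ s ^ suc k + k * v ^ suc k)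
                         (m∸n+n≡m v≤s) (young-above k v (s ∸ v))
  ... | inj₂ s≤v = subst (λ v → suc k * s * v ^ k ≤ s ^ suc k + k * v ^ suc k)
                         (m∸n+n≡m s≤v) (young-below k s (v ∸ s))

  amgm-step : ∀ k x T → suc k ^ suc k * x * T ^ k ≤ k ^ k * (x + T) ^ suc k
  amgm-step zero x T = begin
    1 * 1 * x * 1        ≡⟨ unit x ⟩
    x                    ≤⟨ m≤m+n x T ⟩
    x + T                ≡⟨ unit′ (x + T) ⟨
    1 * ((x + T) * 1)    ∎
    where
      unit : ∀ x → 1 * 1 * x * 1 ≡ x
      unit = solve-∀
      unit′ : ∀ y → 1 * (y * 1) ≡ y
      unit′ = solve-∀
  amgm-step k@(suc _) x T = *-cancelˡ-≤ k (+-cancelʳ-≤ R _ _ (begin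
    k * (suc k * A * x * B) + R                       ≡⟨ gather k x T A B ⟩
    suc k * (k * (x + T)) * (A * B)                   ≡⟨ cong (suc k * (k * (x + T)) *_) (^-distribʳ-* (suc k) T k) ⟨
    suc k * (k * (x + T)) * (suc k * T) ^ k           ≤⟨ young k (k * (x + T)) (suc k * T) ⟩
    (k * (x + T)) ^ suc k + k * (suc k * T) ^ suc k   ≡⟨ cong₂ _+_ (^-distribʳ-* k (x + T) (suc k))
                                                               (cong (k *_) (^-distribʳ-* (suc k) T (suc k))) ⟩
    k ^ suc k * (x + T) ^ suc k + R                   ≡⟨ cong (_+ R) (*-assoc k (k ^ k) _) ⟩
    k * (k ^ k * (x + T) ^ suc k) + R                 ∎))
    where
      A = suc k ^ k
      B = T ^ k
      R = k * (suc k * A * (T * B))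
      gather : ∀ k x T A B → k * (suc k * A * x * B) + k * (suc k * A * (T * B))
                             ≡ suc k * (k * (x + T)) * (A * B)
      gather = solve-∀

  k^k≢0 : ∀ k → NonZero (k ^ k)
  k^k≢0 zero = _
  k^k≢0 k@(suc _) = m^n≢0 k k

  amgm : ∀ xs → length xs ^ length xs * product xs ≤ sum xs ^ length xs
  amgm [] = ≤-refl
  amgm (x ∷ xs) = *-cancelˡ-≤ (k ^ k) {{k^k≢0 k}} (begin
    k ^ k * (suc k ^ suc k * (x * P))  ≡⟨ regroup (k ^ k) (suc k ^ suc k) x P ⟩
    suc k ^ suc k * x * (k ^ k * P)    ≤⟨ *-monoʳ-≤ (suc k ^ suc k * x) (amgm xs) ⟩
    suc k ^ suc k * x * T ^ k          ≤⟨ amgm-step k x T ⟩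
    k ^ k * (x + T) ^ suc k            ∎)
    where
      k = length xs
      P = product xs
      T = sum xs
      regroup : ∀ a b x P → a * (b * (x * P)) ≡ b * x * (a * P)
      regroup = solve-∀

  -- Falling factorials

  n<k⇒nP′k≡0 : ∀ {n k} → n < k → n P′ k ≡ 0
  n<k⇒nP′k≡0 {n} {suc k} (s≤s n≤k) with m≤n⇒m<n∨m≡n n≤k
  ... | inj₁ n<k = trans (cong ((n ∸ k) *_) (n<k⇒nP′k≡0 n<k)) (*-zeroʳ (n ∸ k))
  ... | inj₂ refl = cong (_* (n P′ n)) (n∸n≡0 n)

  k!*nCk≡nP′k : ∀ n k → k ! * (n C k) ≡ n P′ k
  k!*nCk≡nP′k n k with k ≤? n
  ... | yes k≤n = begin-equality
    k ! * (n C k)                  ≡⟨ cong (k ! *_) (trans (nCk≡nPk/k! k≤n) (cong (_/ k !) (nPk≡n!/[n∸k]! k≤n))) ⟩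
    k ! * (n ! / (n ∸ k) ! / k !)  ≡⟨ cong (λ m → k ! * (m / k !)) (nP′k≡n!/[n∸k]! k≤n) ⟨
    k ! * ((n P′ k) / k !)         ≡⟨ m*[n/m]≡n (k!∣nP′k k≤n) ⟩
    n P′ k                         ∎
    where
      instance
        k!≢0 : NonZero (k !)
        k!≢0 = k !≢0
        [n∸k]!≢0 : NonZero ((n ∸ k) !)
        [n∸k]!≢0 = (n ∸ k) !≢0
  ... | no k≰n = begin-equality
    k ! * (n C k)   ≡⟨ cong (k ! *_) (k>n⇒nCk≡0 (≰⇒> k≰n)) ⟩
    k ! * 0         ≡⟨ *-zeroʳ (k !) ⟩
    0               ≡⟨ n<k⇒nP′k≡0 (≰⇒> k≰n) ⟨
    n P′ k          ∎

  nP′k≤n^k : ∀ n k → n P′ k ≤ n ^ k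
  nP′k≤n^k n zero = ≤-refl
  nP′k≤n^k n (suc k) = *-mono-≤ (m∸n≤m n k) (nP′k≤n^k n k)

  nP′k>0 : ∀ {n k} → k ≤ n → 0 < n P′ k
  nP′k>0 {k = zero} _ = s≤s z≤n
  nP′k>0 {k = suc k} k<n = *-mono-≤ (m<n⇒0<n∸m k<n) (nP′k>0 (<⇒≤ k<n))

  P′-decay : ∀ {n₀ n} r → r ≤ n₀ → n₀ ^ suc r ≤ n → (n P′ r) * n₀ ^ suc r ≤ (n₀ P′ r) * n ^ suc r
  P′-decay {n₀} {n} r r≤n₀ n₀^[1+r]≤n = begin
    (n P′ r) * n₀ ^ suc r    ≤⟨ *-mono-≤ (nP′k≤n^k n r) n₀^[1+r]≤n ⟩
    n ^ r * n                ≡⟨ *-comm (n ^ r) n ⟩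
    n ^ suc r                ≡⟨ *-identityˡ (n ^ suc r) ⟨
    1 * n ^ suc r            ≤⟨ *-monoˡ-≤ (n ^ suc r) (nP′k>0 r≤n₀) ⟩
    (n₀ P′ r) * n ^ suc r    ∎

  triangle : ℕ → ℕ
  triangle r = sum (downFrom r)

  2*triangle+r≡r*r : ∀ r → 2 * triangle r + r ≡ r * r
  2*triangle+r≡r*r zero = refl
  2*triangle+r≡r*r (suc r) = begin-equality
    2 * (r + triangle r) + suc r   ≡⟨ regroup r (triangle r) ⟩
    2 * triangle r + r + suc (r + r) ≡⟨ cong (_+ suc (r + r)) (2*triangle+r≡r*r r) ⟩
    r * r + suc (r + r)            ≡⟨ square r ⟩
    suc r * suc r                  ∎
    where
      regroup : ∀ r t → 2 * (r + t) + suc r ≡ 2 * t + r + suc (r + r)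
      regroup = solve-∀
      square : ∀ r → r * r + suc (r + r) ≡ suc r * suc r
      square = solve-∀

  r*r∸r≡2*triangle : ∀ r → r * r ∸ r ≡ 2 * triangle r
  r*r∸r≡2*triangle r = trans (cong (_∸ r) (sym (2*triangle+r≡r*r r))) (m+n∸n≡m (2 * triangle r) r)

  product-applyDownFrom-∸ : ∀ n r → product (applyDownFrom (n ∸_) r) ≡ n P′ r
  product-applyDownFrom-∸ n zero = refl
  product-applyDownFrom-∸ n (suc r) = cong ((n ∸ r) *_) (product-applyDownFrom-∸ n r)

  triangle+sum-applyDownFrom-∸ : ∀ {n r} → r ≤ n → triangle r + sum (applyDownFrom (n ∸_) r) ≡ r * n
  triangle+sum-applyDownFrom-∸ {n} {zero} _ = refl
  triangle+sum-applyDownFrom-∸ {n} {suc r} r<n = begin-equality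
    (r + triangle r) + ((n ∸ r) + S)  ≡⟨ regroup r (triangle r) (n ∸ r) S ⟩
    (r + (n ∸ r)) + (triangle r + S)  ≡⟨ cong₂ _+_ (m+[n∸m]≡n (<⇒≤ r<n)) (triangle+sum-applyDownFrom-∸ (<⇒≤ r<n)) ⟩
    n + r * n                         ∎
    where
      S = sum (applyDownFrom (n ∸_) r)
      regroup : ∀ r t d S → (r + t) + (d + S) ≡ (r + d) + (t + S)
      regroup = solve-∀

  amgm-falling : ∀ n r → suc r ^ suc r * (triangle r * (n P′ r)) ≤ (r * n) ^ suc r
  amgm-falling n r with r ≤? n
  ... | yes r≤n = subst₂ _≤_
    (cong₂ (λ k p → suc k ^ suc k * (triangle r * p)) (length-applyDownFrom (n ∸_) r) (product-applyDownFrom-∸ n r))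
    (cong₂ (λ t k → t ^ suc k) (triangle+sum-applyDownFrom-∸ r≤n) (length-applyDownFrom (n ∸_) r))
    (amgm (triangle r ∷ applyDownFrom (n ∸_) r))
  ... | no r≰n rewrite n<k⇒nP′k≡0 (≰⇒> r≰n) | *-zeroʳ (triangle r) | *-zeroʳ (suc r ^ suc r) = z≤n

  -- The truncated exponential series

  -- expPoly k s q = Σ_{j ≤ k} (k!/j!) s^j q^(k−j) = k! q^k e_k(s/q)
  expPoly : ℕ → ℕ → ℕ → ℕ
  expPoly zero s q = 1
  expPoly (suc k) s q = suc k * q * expPoly k s q + s ^ suc k

  eSumNumerator : ℕ → ℕ
  eSumNumerator zero = 1
  eSumNumerator (suc N) = suc N * eSumNumerator N + 1

  expPoly-zero : ∀ N q → expPoly N 0 q ≡ N ! * q ^ N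
  expPoly-zero zero q = refl
  expPoly-zero (suc N) q = begin-equality
    suc N * q * expPoly N 0 q + 0   ≡⟨ cong (λ e → suc N * q * e + 0) (expPoly-zero N q) ⟩
    suc N * q * (N ! * q ^ N) + 0   ≡⟨ regroup N q (N !) (q ^ N) ⟩
    suc N ! * (q * q ^ N)           ∎
    where
      regroup : ∀ N q F Q → suc N * q * (F * Q) + 0 ≡ (F + N * F) * (q * Q)
      regroup = solve-∀

  expPoly-diagonal : ∀ k s → expPoly k s s ≡ s ^ k * eSumNumerator k
  expPoly-diagonal zero s = refl
  expPoly-diagonal (suc k) s = begin-equality
    suc k * s * expPoly k s s + s * s ^ k              ≡⟨ cong (λ e → suc k * s * e + s * s ^ k) (expPoly-diagonal k s) ⟩
    suc k * s * (s ^ k * eSumNumerator k) + s * s ^ k  ≡⟨ regroup k s (s ^ k) (eSumNumerator k) ⟩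
    s * s ^ k * (suc k * eSumNumerator k + 1)          ∎
    where
      regroup : ∀ k s S E → suc k * s * (S * E) + s * S ≡ s * S * (suc k * E + 1)
      regroup = solve-∀

  expPoly-increment-≤ : ∀ N x s q → expPoly (suc N) (x + s) q ≤ expPoly (suc N) s q + x * suc N * expPoly N (x + s) q
  expPoly-increment-≤ zero x s q = ≤-reflexive (regroup q s x)
    where
      regroup : ∀ q s x → 1 * q * 1 + (x + s) * 1 ≡ (1 * q * 1 + s * 1) + x * 1 * 1
      regroup = solve-∀
  expPoly-increment-≤ (suc N) x s q = begin
    suc k * q * expPoly k (x + s) q + (x + s) ^ suc k
      ≤⟨ +-mono-≤ (*-monoʳ-≤ (suc k * q) (expPoly-increment-≤ N x s q)) (^-increment-≤ x s k) ⟩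
    suc k * q * (expPoly k s q + x * k * expPoly N (x + s) q) + (s ^ suc k + suc k * x * (x + s) ^ k)
      ≡⟨ regroup k q (expPoly k s q) x (expPoly N (x + s) q) (s ^ suc k) ((x + s) ^ k) ⟩
    (suc k * q * expPoly k s q + s ^ suc k) + x * suc k * (k * q * expPoly N (x + s) q + (x + s) ^ k) ∎
    where
      k = suc N
      regroup : ∀ k q E x E′ S X → suc k * q * (E + x * k * E′) + (S + suc k * x * X)
                                   ≡ (suc k * q * E + S) + x * suc k * (k * q * E′ + X)
      regroup = solve-∀

  expPoly-increment-≥ : ∀ k x s q → expPoly (suc k) s q + x * suc k * expPoly k s q ≤ expPoly (suc k) (x + s) q
  expPoly-increment-≥ zero x s q = ≤-reflexive (regroup q s x)
    where
      regroup : ∀ q s x → (1 * q * 1 + s * 1) + x * 1 * 1 ≡ 1 * q * 1 + (x + s) * 1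
      regroup = solve-∀
  expPoly-increment-≥ (suc j) x s q = begin
    (suc k * q * expPoly k s q + s ^ suc k) + x * suc k * (k * q * expPoly j s q + s ^ k)
      ≡⟨ regroup k q (expPoly k s q) x (expPoly j s q) (s ^ suc k) (s ^ k) ⟩
    suc k * q * (expPoly k s q + x * k * expPoly j s q) + (s ^ suc k + suc k * x * s ^ k)
      ≤⟨ +-mono-≤ (*-monoʳ-≤ (suc k * q) (expPoly-increment-≥ j x s q)) (bernoulli x s k) ⟩
    suc k * q * expPoly k (x + s) q + (x + s) ^ suc k ∎
    where
      k = suc j
      regroup : ∀ k q E x E′ S X → (suc k * q * E + S) + x * suc k * (k * q * E′ + X)
                                   ≡ suc k * q * (E + x * k * E′) + (S + suc k * x * X)
      regroup = solve-∀

  expPoly-step-≥ : ∀ k x s q → suc k * (x + q) * expPoly k s q ≤ expPoly (suc k) (x + s) q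
  expPoly-step-≥ k x s q = begin
    suc k * (x + q) * E                          ≡⟨ expand k x q E ⟩
    suc k * q * E + x * suc k * E                ≤⟨ +-monoˡ-≤ (x * suc k * E) (m≤m+n (suc k * q * E) (s ^ suc k)) ⟩
    (suc k * q * E + s ^ suc k) + x * suc k * E  ≤⟨ expPoly-increment-≥ k x s q ⟩
    expPoly (suc k) (x + s) q                    ∎
    where
      E = expPoly k s q
      expand : ∀ k x q E → suc k * (x + q) * E ≡ suc k * q * E + x * suc k * E
      expand = solve-∀

  expPoly-scaled-≤ : ∀ p d M N → d ^ M * expPoly N (M * p) (p + d) ≤ N ! * (p + d) ^ (M + N)
  expPoly-scaled-≤ p d zero N = ≤-reflexive (trans (*-identityˡ _) (expPoly-zero N (p + d)))
  expPoly-scaled-≤ p d (suc M) zero = begin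
    d ^ suc M * 1          ≡⟨ *-identityʳ _ ⟩
    d ^ suc M              ≤⟨ ^-monoˡ-≤ (suc M) (m≤n+m d p) ⟩
    q ^ suc M              ≡⟨ cong (q ^_) (+-identityʳ (suc M)) ⟨
    q ^ (suc M + 0)        ≡⟨ *-identityˡ _ ⟨
    1 * q ^ (suc M + 0)    ∎
    where q = p + d
  expPoly-scaled-≤ p d (suc M) (suc N) = begin
    d ^ suc M * expPoly (suc N) (p + M * p) q
      ≤⟨ *-monoʳ-≤ (d ^ suc M) (expPoly-increment-≤ N p (M * p) q) ⟩
    d ^ suc M * (expPoly (suc N) (M * p) q + p * suc N * expPoly N (suc M * p) q)
      ≡⟨ regroup d (d ^ M) (expPoly (suc N) (M * p) q) p N (expPoly N (suc M * p) q) ⟩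
    d * (d ^ M * expPoly (suc N) (M * p) q) + p * suc N * (d ^ suc M * expPoly N (suc M * p) q)
      ≤⟨ +-mono-≤ (*-monoʳ-≤ d (expPoly-scaled-≤ p d M (suc N)))
                  (*-monoʳ-≤ (p * suc N) (expPoly-scaled-≤ p d (suc M) N)) ⟩
    d * (suc N ! * q ^ (M + suc N)) + p * suc N * (N ! * q ^ (suc M + N))
      ≡⟨ cong (λ e → d * (suc N ! * q ^ (M + suc N)) + p * suc N * (N ! * q ^ e)) (+-suc M N) ⟨
    d * (suc N ! * q ^ (M + suc N)) + p * suc N * (N ! * q ^ (M + suc N))
      ≡⟨ collect N (N !) d p (q ^ (M + suc N)) ⟩
    suc N ! * (q * q ^ (M + suc N)) ∎
    where
      q = p + d
      regroup : ∀ d D A p N B → d * D * (A + p * suc N * B) ≡ d * (D * A) + p * suc N * (d * D * B)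
      regroup = solve-∀
      collect : ∀ N F d p E → d * ((F + N * F) * E) + p * suc N * (F * E) ≡ (F + N * F) * ((p + d) * E)
      collect = solve-∀

  eSumNumerator-≤ : ∀ r N → eSumNumerator N * r ^ suc r ≤ N ! * suc r ^ suc r
  eSumNumerator-≤ r N = *-cancelˡ-≤ (q ^ N) {{m^n≢0 q N}} (begin
    q ^ N * (eSumNumerator N * r ^ q)   ≡⟨ regroup (q ^ N) (eSumNumerator N) (r ^ q) ⟩
    r ^ q * (q ^ N * eSumNumerator N)   ≡⟨ cong (r ^ q *_) (expPoly-diagonal N q) ⟨
    r ^ q * expPoly N q q               ≡⟨ cong (λ s → r ^ q * expPoly N s q) (*-identityʳ q) ⟨
    r ^ q * expPoly N (q * 1) (1 + r)   ≤⟨ expPoly-scaled-≤ 1 r q N ⟩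
    N ! * q ^ (q + N)                   ≡⟨ cong (N ! *_) (^-distribˡ-+-* q q N) ⟩
    N ! * (q ^ q * q ^ N)               ≡⟨ regroup (N !) (q ^ q) (q ^ N) ⟩
    q ^ N * (N ! * q ^ q)               ∎)
    where
      q = suc r
      regroup : ∀ a b c → a * (b * c) ≡ c * (a * b)
      regroup = solve-∀

  falling-eSum-≤ : ∀ n r N → (n P′ r) * eSumNumerator N * (r * r ∸ r) ≤ 2 * (n ^ suc r * N !)
  falling-eSum-≤ n r N = *-cancelˡ-≤ Q {{m^n≢0 (suc r) (suc r)}} (begin
    Q * ((n P′ r) * E * (r * r ∸ r))  ≡⟨ cong (λ c → Q * ((n P′ r) * E * c)) (r*r∸r≡2*triangle r) ⟩
    Q * ((n P′ r) * E * (2 * t))      ≡⟨ regroup Q (n P′ r) E t ⟩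
    2 * E * (Q * (t * (n P′ r)))      ≤⟨ *-monoʳ-≤ (2 * E) (amgm-falling n r) ⟩
    2 * E * (r * n) ^ suc r           ≡⟨ cong (2 * E *_) (^-distribʳ-* r n (suc r)) ⟩
    2 * E * (r ^ suc r * n ^ suc r)   ≡⟨ regroup′ E (r ^ suc r) (n ^ suc r) ⟩
    2 * n ^ suc r * (E * r ^ suc r)   ≤⟨ *-monoʳ-≤ (2 * n ^ suc r) (eSumNumerator-≤ r N) ⟩
    2 * n ^ suc r * (N ! * Q)         ≡⟨ regroup″ (n ^ suc r) (N !) Q ⟩
    Q * (2 * (n ^ suc r * N !))       ∎)
    where
      Q = suc r ^ suc r
      E = eSumNumerator N
      t = triangle r
      regroup : ∀ Q P E t → Q * (P * E * (2 * t)) ≡ 2 * E * (Q * (t * P))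
      regroup = solve-∀
      regroup′ : ∀ E a b → 2 * E * (a * b) ≡ 2 * b * (E * a)
      regroup′ = solve-∀
      regroup″ : ∀ a b c → 2 * a * (b * c) ≡ c * (2 * (a * b))
      regroup″ = solve-∀

  *-balance-≤ : ∀ {a b} k → k + a ≤ b → b * a ≤ (b ∸ k) * (k + a)
  *-balance-≤ {a} k k+a≤b with m≤n⇒∃[o]m+o≡n k+a≤b
  ... | t , refl = begin
    (k + a + t) * a             ≤⟨ m≤m+n _ (t * k) ⟩
    (k + a + t) * a + t * k     ≡⟨ expand k a t ⟩
    (a + t) * (k + a)           ≡⟨ cong (_* (k + a)) (trans (cong (_∸ k) (+-assoc k a t)) (m+n∸m≡n k (a + t))) ⟨
    (k + a + t ∸ k) * (k + a)   ∎
    where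
      expand : ∀ k a t → (k + a + t) * a + t * k ≡ (a + t) * (k + a)
      expand = solve-∀

  falling-expPoly-≥ : ∀ {a b} k → k + a ≤ b → (b * a) ^ k * k ! ≤ (b P′ k) * expPoly k (triangle k) a
  falling-expPoly-≥ zero _ = ≤-refl
  falling-expPoly-≥ {a} {b} (suc k) k<b = begin
    (b * a) ^ suc k * suc k !                    ≡⟨ regroup (b * a) ((b * a) ^ k) k (k !) ⟩
    b * a * suc k * ((b * a) ^ k * k !)          ≤⟨ *-monoʳ-≤ (b * a * suc k) (falling-expPoly-≥ k k+a≤b) ⟩
    b * a * suc k * ((b P′ k) * E)               ≤⟨ *-monoˡ-≤ ((b P′ k) * E) (*-monoˡ-≤ (suc k) (*-balance-≤ k k+a≤b)) ⟩
    (b ∸ k) * (k + a) * suc k * ((b P′ k) * E)   ≡⟨ regroup′ (b ∸ k) (k + a) k (b P′ k) E ⟩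
    (b ∸ k) * (b P′ k) * (suc k * (k + a) * E)   ≤⟨ *-monoʳ-≤ ((b ∸ k) * (b P′ k)) (expPoly-step-≥ k k (triangle k) a) ⟩
    (b ∸ k) * (b P′ k) * expPoly (suc k) (k + triangle k) a ∎
    where
      E = expPoly k (triangle k) a
      k+a≤b : k + a ≤ b
      k+a≤b = <⇒≤ k<b
      regroup : ∀ c X k F → c * X * (F + k * F) ≡ c * suc k * (X * F)
      regroup = solve-∀
      regroup′ : ∀ d c k P E → d * c * suc k * (P * E) ≡ d * P * (suc k * c * E)
      regroup′ = solve-∀

  falling-triangle-≥ : ∀ r .{{_ : NonZero (triangle r)}} →
                       triangle (suc r) ^ r * r ! ≤ (triangle (suc r) P′ r) * eSumNumerator r
  falling-triangle-≥ r = *-cancelˡ-≤ (a ^ r) {{m^n≢0 a r}} (begin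
    a ^ r * (b ^ r * r !)                 ≡⟨ regroup (a ^ r) (b ^ r) (r !) ⟩
    b ^ r * a ^ r * r !                   ≡⟨ cong (_* r !) (^-distribʳ-* b a r) ⟨
    (b * a) ^ r * r !                     ≤⟨ falling-expPoly-≥ r ≤-refl ⟩
    (b P′ r) * expPoly r a a              ≡⟨ cong ((b P′ r) *_) (expPoly-diagonal r a) ⟩
    (b P′ r) * (a ^ r * eSumNumerator r)  ≡⟨ x*[y*z]≡y*[x*z] (b P′ r) (a ^ r) (eSumNumerator r) ⟩
    a ^ r * ((b P′ r) * eSumNumerator r)  ∎)
    where
      a = triangle r
      b = triangle (suc r)
      regroup : ∀ x y z → x * (y * z) ≡ y * x * z
      regroup = solve-∀
      x*[y*z]≡y*[x*z] : ∀ x y z → x * (y * z) ≡ y * (x * z)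
      x*[y*z]≡y*[x*z] = solve-∀

  falling-eSum-≥ : ∀ r .{{_ : NonZero (triangle r)}} →
                   2 * (triangle (suc r) ^ suc r * r !) ≤ (triangle (suc r) P′ r) * eSumNumerator r * (r * r + r)
  falling-eSum-≥ r = begin
    2 * (b * b ^ r * r !)                     ≡⟨ regroup b (b ^ r) (r !) ⟩
    2 * b * (b ^ r * r !)                     ≤⟨ *-monoʳ-≤ (2 * b) (falling-triangle-≥ r) ⟩
    2 * b * ((b P′ r) * eSumNumerator r)      ≡⟨ *-comm (2 * b) _ ⟩
    (b P′ r) * eSumNumerator r * (2 * b)      ≡⟨ cong ((b P′ r) * eSumNumerator r *_) 2*triangle[1+r]≡r*r+r ⟩
    (b P′ r) * eSumNumerator r * (r * r + r)  ∎
    where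
      b = triangle (suc r)
      regroup : ∀ b c d → 2 * (b * c * d) ≡ 2 * b * (c * d)
      regroup = solve-∀
      2*triangle[1+r]≡r*r+r : 2 * b ≡ r * r + r
      2*triangle[1+r]≡r*r+r = trans (double-sum r (triangle r)) (cong (_+ r) (2*triangle+r≡r*r r))
        where
          double-sum : ∀ r t → 2 * (r + t) ≡ 2 * t + r + r
          double-sum = solve-∀

module _ {a ℓ₁ ℓ₂} (O : TotalPreorder a ℓ₁ ℓ₂) where
  open TotalPreorder O using (_≲_; total) renaming (Carrier to A; refl to ≲-refl; trans to ≲-trans)
  open import Data.Nat using (ℕ; zero; suc; _≤_; _<_; z≤n; s≤s; _≤?_)
  open import Data.Nat.Properties using (m≤n⇒m<n∨m≡n; ≰⇒>)

  bound-extend : (f : ℕ → A) {K : ℕ} {y : A} →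
                 (∀ k → k ≤ K → f k ≲ y) → f (suc K) ≲ y → ∀ k → k ≤ suc K → f k ≲ y
  bound-extend f below top k k≤1+K with m≤n⇒m<n∨m≡n k≤1+K
  ... | inj₁ (s≤s k≤K) = below k k≤K
  ... | inj₂ refl = top

  maximum-≤ : (f : ℕ → A) (K : ℕ) → Σ ℕ λ m → ∀ k → k ≤ K → f k ≲ f m
  maximum-≤ f zero = zero , λ { zero z≤n → ≲-refl }
  maximum-≤ f (suc K) with maximum-≤ f K
  ... | m , m-max with total (f m) (f (suc K))
  ...   | inj₁ fm≲fK = suc K , bound-extend f (λ k k≤K → ≲-trans (m-max k k≤K) fm≲fK) ≲-refl
  ...   | inj₂ fK≲fm = m , bound-extend f m-max fK≲fm

  maximum : (f : ℕ → A) (m₀ K : ℕ) → m₀ ≤ K → (∀ k → K < k → f k ≲ f m₀) → Σ ℕ λ m → ∀ k → f k ≲ f m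
  maximum f m₀ K m₀≤K tail with maximum-≤ f K
  ... | m , m-max = m , λ k → case k ≤? K of λ where
    (yes k≤K) → m-max k k≤K
    (no k≰K) → ≲-trans (tail k (≰⇒> k≰K)) (m-max m₀ m₀≤K)

open import Data.Nat as ℕ using (ℕ; zero; suc; _≤_; NonZero; _!; _^_; s≤s; z≤n)
open import Data.Integer using (+_)
open import Data.Rational using (ℚ; _*_; _-_; _<_; _/_; 0ℚ) renaming (_≤_ to _≤ℚ_)
open import Data.Nat.Properties as ℕP using (_!≢0; m^n≢0; m*n≢0)
open import Data.Nat.Combinatorics.Base using (_P′_)
import Data.Integer as ℤ
import Data.Integer.Properties as ℤP
open import Data.Rational using (toℚᵘ; NonNegative; nonNegative; _+_)
import Data.Rational.Properties as ℚP
open import Data.Rational.Unnormalised using (mkℚᵘ; *≡*; *≤*) renaming (_≃_ to _≃ᵘ_)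
import Data.Rational.Unnormalised.Properties as ℚᵘP
open import Data.Nat.Tactic.RingSolver using (solve-∀)

-- p = a / b; the denominator is stored as pred b, so the lemmas below need b ≠ 0.
record Fraction (p : ℚ) (a b : ℕ) : Set where
  constructor fraction
  field
    toℚᵘ-≃ : toℚᵘ p ≃ᵘ mkℚᵘ (+ a) (ℕ.pred b)

fraction-/ : ∀ a b .{{_ : NonZero b}} → Fraction ((+ a) / b) a b
fraction-/ a (suc b) = fraction (ℚP.toℚᵘ-fromℚᵘ (mkℚᵘ (+ a) b))

fraction-* : ∀ {p q a b c d} .{{_ : NonZero b}} .{{_ : NonZero d}} →
             Fraction p a b → Fraction q c d → Fraction (p * q) (a ℕ.* c) (b ℕ.* d)
fraction-* {p} {q} {a} {suc _} {c} {suc _} (fraction p≃) (fraction q≃) = fraction (ℚᵘP.≃-trans (ℚP.toℚᵘ-homo-* p q)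
  (ℚᵘP.≃-trans (ℚᵘP.*-cong p≃ q≃) (ℚᵘP.≃-reflexive (cong (λ z → mkℚᵘ z _) (sym (ℤP.pos-* a c))))))

fraction-≤ : ∀ {p q a b c d} .{{_ : NonZero b}} .{{_ : NonZero d}} →
             Fraction p a b → Fraction q c d → a ℕ.* d ≤ c ℕ.* b → p ≤ℚ q
fraction-≤ {a = a} {suc b} {c} {suc d} (fraction p≃) (fraction q≃) ad≤cb =
  ℚP.toℚᵘ-cancel-≤ (ℚᵘP.≤-respˡ-≃ (ℚᵘP.≃-sym p≃) (ℚᵘP.≤-respʳ-≃ (ℚᵘP.≃-sym q≃)
    (*≤* (subst₂ ℤ._≤_ (ℤP.pos-* a (suc d)) (ℤP.pos-* c (suc b)) (ℤ.+≤+ ad≤cb)))))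

fraction-nonNegative : ∀ {p a b} .{{_ : NonZero b}} → Fraction p a b → NonNegative p
fraction-nonNegative p≃ = nonNegative (fraction-≤ (fraction-/ 0 1) p≃ z≤n)

fraction-+ : ∀ {p q a b c d} .{{_ : NonZero b}} .{{_ : NonZero d}} →
             Fraction p a b → Fraction q c d → Fraction (p + q) (a ℕ.* d ℕ.+ c ℕ.* b) (b ℕ.* d)
fraction-+ {p} {q} {a} {b@(suc _)} {c} {d@(suc _)} (fraction p≃) (fraction q≃) = fraction (ℚᵘP.≃-trans (ℚP.toℚᵘ-homo-+ p q)
  (ℚᵘP.≃-trans (ℚᵘP.+-cong p≃ q≃) (ℚᵘP.≃-reflexive (cong (λ z → mkℚᵘ z _)
    (sym (trans (ℤP.pos-+ (a ℕ.* d) (c ℕ.* b)) (cong₂ ℤ._+_ (ℤP.pos-* a d) (ℤP.pos-* c b))))))))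

fraction-rescale : ∀ {p a b c d} .{{_ : NonZero b}} .{{_ : NonZero d}} →
                   a ℕ.* d ≡ c ℕ.* b → Fraction p a b → Fraction p c d
fraction-rescale {a = a} {b@(suc _)} {c} {d@(suc _)} ad≡cb (fraction p≃) =
  fraction (ℚᵘP.≃-trans p≃ (*≡* (trans (sym (ℤP.pos-* a d)) (trans (cong +_ ad≡cb) (ℤP.pos-* c b)))))

fraction-eSum : ∀ N → Fraction (eSum N) (eSumNumerator N) (N !)
fraction-eSum zero = fraction-/ 1 1
fraction-eSum (suc N) = fraction-rescale {{m*n≢0 (N !) (suc N !) {{N !≢0}} {{suc N !≢0}}}} {{suc N !≢0}}
  (common-denominator N (eSumNumerator N) (N !))
  (fraction-+ {{N !≢0}} {{suc N !≢0}} (fraction-eSum N) (fraction-/ 1 (suc N !) {{suc N !≢0}}))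
  where
    common-denominator : ∀ N E F → (E ℕ.* (F ℕ.+ N ℕ.* F) ℕ.+ 1 ℕ.* F) ℕ.* (F ℕ.+ N ℕ.* F)
                                   ≡ (suc N ℕ.* E ℕ.+ 1) ℕ.* (F ℕ.* (F ℕ.+ N ℕ.* F))
    common-denominator = solve-∀

fraction-term : ∀ r m → Fraction (term r m) (suc m P′ r) (suc m ^ suc r)
fraction-term r m = subst (λ a → Fraction (term r m) a (suc m ^ suc r)) (k!*nCk≡nP′k (suc m) r)
  (fraction-/ _ _ {{m^n≢0 (suc m) (suc r)}})

fraction-*-integer : ∀ {p a b} c .{{_ : NonZero b}} → Fraction p a b → Fraction (p * ((+ c) / 1)) (a ℕ.* c) b
fraction-*-integer {b = b} c p≃ = subst (Fraction _ _) (ℕP.*-identityʳ b) (fraction-* p≃ (fraction-/ c 1))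

fraction-term-eSum : ∀ r m N c →
  Fraction (term r m * eSum N * ((+ c) / 1)) ((suc m P′ r) ℕ.* eSumNumerator N ℕ.* c) (suc m ^ suc r ℕ.* N !)
fraction-term-eSum r m N c = fraction-*-integer c {{denominator≢0}}
  (fraction-* {{m^n≢0 (suc m) (suc r)}} {{N !≢0}} (fraction-term r m) (fraction-eSum N))
  where
    denominator≢0 : NonZero (suc m ^ suc r ℕ.* N !)
    denominator≢0 = m*n≢0 _ _ {{m^n≢0 (suc m) (suc r)}} {{N !≢0}}

term-upper : ∀ r m N → term r m * eSum N * ((+ (r ℕ.* r ℕ.∸ r)) / 1) ≤ℚ (+ 2) / 1
term-upper r m N = fraction-≤ {{m*n≢0 _ _ {{m^n≢0 (suc m) (suc r)}} {{N !≢0}}}} (fraction-term-eSum r m N _) (fraction-/ 2 1)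
  (ℕP.≤-trans (ℕP.≤-reflexive (ℕP.*-identityʳ _)) (falling-eSum-≤ (suc m) r N))

term-lower : ∀ r′ → .{{_ : NonZero (triangle (suc r′))}} →
  (+ 2) / 1 ≤ℚ term (suc r′) (r′ ℕ.+ triangle (suc r′)) * eSum (suc r′) * ((+ (suc r′ ℕ.* suc r′ ℕ.+ suc r′)) / 1)
term-lower r′ = fraction-≤ {{_}} {{m*n≢0 _ _ {{m^n≢0 (triangle (suc r)) (suc r)}} {{r !≢0}}}}
  (fraction-/ 2 1) (fraction-term-eSum r (r′ ℕ.+ triangle r) r _)
  (ℕP.≤-trans (falling-eSum-≥ r) (ℕP.≤-reflexive (sym (ℕP.*-identityʳ _))))
  where r = suc r′

term-tail : ∀ r m₀ k → r ≤ suc m₀ → suc m₀ ^ suc r ℕ.< k → term r k ≤ℚ term r m₀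
term-tail r m₀ k r≤n₀ K<k = fraction-≤ {{m^n≢0 (suc k) (suc r)}} {{m^n≢0 (suc m₀) (suc r)}}
  (fraction-term r k) (fraction-term r m₀) (P′-decay r r≤n₀ (ℕP.m≤n⇒m≤1+n (ℕP.<⇒≤ K<k)))

p-q<p : ∀ p {q} → 0ℚ < q → p - q < p
p-q<p p {q} q>0 = subst (p - q <_) (ℚP.+-identityʳ p) (ℚP.+-monoʳ-< p (ℚP.neg-antimono-< q>0))

theorem4 : (r : ℕ) → 2 ≤ r →
    Σ ℕ (λ m →
      ((k : ℕ) → term r k ≤ℚ term r m)
      × ((ε : ℚ) → 0ℚ < ε → Σ ℕ (λ N →
          ((+ 2) / 1) - ε < term r m * eSum N * ((+ (r ℕ.* r ℕ.+ r)) / 1)))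
      × ((N : ℕ) → term r m * eSum N * ((+ (r ℕ.* r ℕ.∸ r)) / 1) ≤ℚ ((+ 2) / 1)))
theorem4 r@(suc r′) (s≤s 1≤r′) = m , m-max , (λ ε ε>0 → r , lower ε ε>0) , term-upper r m
  where
    instance
      triangle≢0 : NonZero (triangle r)
      triangle≢0 = ℕ.>-nonZero (ℕP.≤-trans 1≤r′ (ℕP.m≤m+n r′ (triangle r′)))
    -- suc m₀ is n₀ = triangle (suc r)
    m₀ : ℕ
    m₀ = r′ ℕ.+ triangle r
    K : ℕ
    K = suc m₀ ^ suc r
    m₀≤K : m₀ ≤ K
    m₀≤K = ℕP.≤-trans (ℕP.n≤1+n m₀) (ℕP.m≤m*n (suc m₀) (suc m₀ ^ r) {{m^n≢0 (suc m₀) r}})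
    r≤n₀ : r ≤ suc m₀
    r≤n₀ = s≤s (ℕP.m≤m+n r′ (triangle r))
    maximiser : Σ ℕ λ m → (k : ℕ) → term r k ≤ℚ term r m
    maximiser = maximum ℚP.≤-totalPreorder (term r) m₀ K m₀≤K (λ k → term-tail r m₀ k r≤n₀)
    m : ℕ
    m = proj₁ maximiser
    m-max : (k : ℕ) → term r k ≤ℚ term r m
    m-max = proj₂ maximiser
    lower : (ε : ℚ) → 0ℚ < ε → ((+ 2) / 1) - ε < term r m * eSum r * ((+ (r ℕ.* r ℕ.+ r)) / 1)
    lower ε ε>0 = ℚP.<-≤-trans (p-q<p ((+ 2) / 1) ε>0) (ℚP.≤-trans (term-lower r′)
      (ℚP.*-monoʳ-≤-nonNeg _ {{fraction-nonNegative (fraction-/ (r ℕ.* r ℕ.+ r) 1)}}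
        (ℚP.*-monoʳ-≤-nonNeg (eSum r) {{fraction-nonNegative {{r !≢0}} (fraction-eSum r)}} (m-max m₀))))
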